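{- Let $T$ be a bidirected tree rooted at a vertex $z$. Then: (i) Two converging requests $r,r'$ interfere if and only if $t_r^-$ and $t_{r'}^-$ are related. (ii) Two diverging requests $r,r'$ interfere if and only if $s_r^+$ and $s_{r'}^+$ are related. (iii) A converging request $r$ and a diverging request $r'$ interfere if and only if $s_r$ and $t_{r'}$ are not related. (iv) Two unimodal requests $r,r'$ do not interfere if and only if $m_r=m_{r'}$, $s_r$ and $t_{r'}$ are related, and $s_{r'}$ and $t_r$ are related. (v) A unimodal request $r$ and a converging request $r'$ do not interfere if and only if $m_r$ is an ancestor of $t_{r'}$ and $t_r$ and $s_{r'}$ are related. (vi) A unimodal request $r$ and a diverging request $r'$ do not interfere if and only if $m_r$ is an ancestor of $s_{r'}$ and $s_r$ and $t_{r'}$ are related.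
   Context: A bidirected tree $T$ is a digraph obtained from a finite undirected tree by replacing each edge $uv$ by the two arcs $(u,v)$ and $(v,u)$. A request in $T$ is a directed path in $T$ with at least one arc. For a directed path $r$, $s_r$ is its first vertex, $t_r$ its last vertex, $s_r^+$ its second vertex and $t_r^-$ its penultimate vertex; its emission arc is $e^+_r=(s_r,s_r^+)$ and its reception arc is $e^-_r=(t_r^-,t_r)$. For vertices $x,y$, $T[x,y]$ denotes the unique directed path from $x$ to $y$ in $T$. A request $r$ interferes on a request $r'$ if $T[s_r,t_{r'}]$ has first arc $e^+_r$ and last arc $e^-_{r'}$; two requests interfere (with each other) if one of them interferes on the other. When $T$ is rooted at $z$: an arc is converging if it is directed towards $z$ and diverging otherwise; a directed path is converging if all its arcs are converging, diverging if all its arcs are diverging, and unimodal otherwise (it is then a converging subpath followed by a diverging subpath). The middle $m_r$ of a directed path $r$ is its vertex closest to $z$. A vertex $x$ is an ancestor of $y$ ($y$ a descendant of $x$) if $T[x,y]$ is diverging (a one-vertex path counts as diverging, so each vertex is its own ancestor); $x$ and $y$ are related if one is an ancestor of the other. -}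

module Defs where

open import Data.Nat using (ℕ; zero; suc; _≤_; _<_)
open import Data.Fin using (Fin)
open import Data.List using (List; []; _∷_; head; last; length)
open import Data.Maybe using (Maybe; just; nothing)
open import Data.Product using (Σ; _×_; _,_; proj₁; proj₂)
open import Data.Sum using (_⊎_)
open import Data.Empty using (⊥)
open import Relation.Nullary using (¬_)
open import Relation.Binary.PropositionalEquality using (_≡_; _≢_)
open import Data.List.Relation.Unary.All using (All)
open import Data.List.Relation.Unary.AllPairs using (AllPairs)
open import Data.List.Relation.Unary.Linked using (Linked)
open import Data.List.Membership.Propositional using (_∈_)

module _ {n : ℕ} (Adj : Fin n → Fin n → Set) where

  IsPath : List (Fin n) → Set
  IsPath p = Linked Adj p × AllPairs _≢_ p

  PathFromTo : Fin n → Fin n → List (Fin n) → Set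
  PathFromTo x y p = IsPath p × head p ≡ just x × last p ≡ just y

  IsCycle : List (Fin n) → Set
  IsCycle c = 3 ≤ length c × IsPath c ×
              Σ (Fin n) λ x → Σ (Fin n) λ y →
                head c ≡ just x × last c ≡ just y × Adj y x

-- A finite undirected tree on vertex set Fin n (given by a symmetric,
-- irreflexive adjacency relation), connected and acyclic.  The
-- bidirected tree has an arc (u,v) exactly when Adj u v.
record Tree (n : ℕ) : Set₁ where
  field
    Adj       : Fin n → Fin n → Set
    symmetric : ∀ {u v} → Adj u v → Adj v u
    irrefl    : ∀ {u} → ¬ Adj u u
    connected : ∀ x y → Σ (List (Fin n)) λ p → PathFromTo Adj x y p
    acyclic   : ∀ c → ¬ IsCycle Adj c

arcs : ∀ {n} → List (Fin n) → List (Fin n × Fin n)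
arcs []           = []
arcs (x ∷ [])     = []
arcs (x ∷ y ∷ xs) = (x , y) ∷ arcs (y ∷ xs)

lastTwo : ∀ {n} → Fin n → Fin n → List (Fin n) → Fin n × Fin n
lastTwo a b []       = a , b
lastTwo a b (c ∷ cs) = lastTwo b c cs

module _ {n : ℕ} (T : Tree n) where
  open Tree T

  record Request : Set where
    constructor request
    field
      s    : Fin n
      s⁺   : Fin n
      rest : List (Fin n)
      isPath : IsPath Adj (s ∷ s⁺ ∷ rest)

  verts : Request → List (Fin n)
  verts r = Request.s r ∷ Request.s⁺ r ∷ Request.rest r

  src : Request → Fin n
  src = Request.s

  src⁺ : Request → Fin n
  src⁺ = Request.s⁺

  tgt⁻ : Request → Fin n
  tgt⁻ r = proj₁ (lastTwo (Request.s r) (Request.s⁺ r) (Request.rest r))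

  tgt : Request → Fin n
  tgt r = proj₂ (lastTwo (Request.s r) (Request.s⁺ r) (Request.rest r))

  -- r interferes on r': the path T[s_r, t_r'] has first arc e⁺_r and
  -- last arc e⁻_r'  (T[x,y] is the unique path from x to y)
  InterferesOn : Request → Request → Set
  InterferesOn r r' =
    Σ (List (Fin n)) λ p → PathFromTo Adj (src r) (tgt r') p ×
      head (arcs p) ≡ just (src r , src⁺ r) ×
      last (arcs p) ≡ just (tgt⁻ r' , tgt r')

  Interfere : Request → Request → Set
  Interfere r r' = InterferesOn r r' ⊎ InterferesOn r' r

  -- distance: T[x,y] has k arcs
  Dist : Fin n → Fin n → ℕ → Set
  Dist x y k = Σ (List (Fin n)) λ p → PathFromTo Adj x y p × length p ≡ suc k

  module _ (z : Fin n) where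

    Converging-arc : Fin n × Fin n → Set
    Converging-arc (u , v) = ∀ k l → Dist u z k → Dist v z l → l < k

    Diverging-arc : Fin n × Fin n → Set
    Diverging-arc a = ¬ Converging-arc a

    ConvergingPath : List (Fin n) → Set
    ConvergingPath p = All Converging-arc (arcs p)

    DivergingPath : List (Fin n) → Set
    DivergingPath p = All Diverging-arc (arcs p)

    Converging : Request → Set
    Converging r = ConvergingPath (verts r)

    Diverging : Request → Set
    Diverging r = DivergingPath (verts r)

    Unimodal : Request → Set
    Unimodal r = ¬ Converging r × ¬ Diverging r

    Ancestor : Fin n → Fin n → Set
    Ancestor x y = Σ (List (Fin n)) λ p → PathFromTo Adj x y p × DivergingPath p

    Related : Fin n → Fin n → Set
    Related x y = Ancestor x y ⊎ Ancestor y x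

    IsMiddle : Request → Fin n → Set
    IsMiddle r m = m ∈ verts r ×
      (∀ v → v ∈ verts r → ∀ k l → Dist m z k → Dist v z l → k ≤ l)

-- Root T at z and write x ⊑ y when x lies on the path from y to z (x is an
-- ancestor of y), a ↑ b when b is the parent of a.  Every arc goes either up
-- or down, and an arc (a , b) lies on T[a , y] exactly when ¬ a ⊑ y if it goes
-- up, and exactly when b ⊑ y if it goes down.  Since r interferes on r′ iff
-- both e⁺_r and e⁻_r′ lie on T[s_r , t_r′], interference becomes a statement
-- about the ancestor order, in which the ancestors of any vertex are pairwise
-- comparable.  The shape of a request fixes the directions of its end arcs
-- (a unimodal request leaves upwards and arrives downwards), and the middle of
-- a request is the meet of its ends; each of the six cases is then a short
-- order-theoretic argument.

module Submission where

open import Defs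
open import Data.Nat using (ℕ; suc; _≤_; _<_; s≤s; z≤n; s<s⁻¹)
open import Data.Nat.Properties using (<-asym; m≤n+m; 1+n≰n; ≤-refl)
open import Data.Fin using (Fin) renaming (_≟_ to _≟ᶠ_)
open import Data.List using (List; []; _∷_; _++_; _∷ʳ_; reverse; length; head; last)
open import Data.List.Properties using (length-++; unfold-reverse; ∷-injectiveˡ; ∷-injectiveʳ)
open import Data.List.Relation.Unary.All as All using (All; []; _∷_)
open import Data.List.Relation.Unary.All.Properties.Core using (¬Any⇒All¬; All¬⇒¬Any)
open import Data.List.Relation.Unary.Any using (here; there)
open import Data.List.Relation.Unary.Any.Properties using (reverse⁺; reverse⁻)
open import Data.List.Relation.Unary.AllPairs using (AllPairs; []; _∷_)
open import Data.List.Relation.Unary.Linked using (Linked; []; [-]; _∷_)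
open import Data.List.Membership.Propositional using (_∈_; _∉_)
open import Data.List.Membership.Propositional.Properties
  using (∈-++⁺ˡ; ∈-++⁺ʳ; ∈-++⁻)
import Data.List.Membership.DecPropositional as DecMembership
open import Data.Maybe using (just)
open import Data.Product using (Σ; _×_; _,_; proj₁; proj₂; uncurry)
open import Data.Sum as Sum using (_⊎_; inj₁; inj₂; [_,_]′; swap)
open import Data.Empty using (⊥; ⊥-elim)
open import Function using (_∘′_; flip; _⇔_; mk⇔; Equivalence)
open import Function.Construct.Composition using (_⇔-∘_)
open import Function.Construct.Symmetry using (⇔-sym)
open import Data.Product.Function.NonDependent.Propositional using (_×-⇔_)
open import Relation.Nullary using (¬_; Dec; yes; no)
open import Relation.Nullary.Decidable using (_⊎-dec_; decidable-stable)
open import Relation.Binary.PropositionalEquality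
  using (_≡_; _≢_; refl; sym; trans; cong; subst; subst₂)

suffixes-nested : ∀ {A : Set} {x x′ : A} xs {ys} xs′ {ys′} →
                  xs ++ x ∷ ys ≡ xs′ ++ x′ ∷ ys′ → x ∈ x′ ∷ ys′ ⊎ x′ ∈ x ∷ ys
suffixes-nested {x′ = x′} []     xs′ eq = inj₂ (subst (x′ ∈_) (sym eq) (∈-++⁺ʳ xs′ (here refl)))
suffixes-nested {x = x} xs@(_ ∷ _) [] eq = inj₁ (subst (x ∈_) eq (∈-++⁺ʳ xs (here refl)))
suffixes-nested (_ ∷ xs) (_ ∷ xs′)  eq = suffixes-nested xs xs′ (∷-injectiveʳ eq)

All-arcs-map : ∀ {n} {R : Fin n → Fin n → Set} {P Q : Fin n × Fin n → Set} →
               (∀ {u v} → R u v → P (u , v) → Q (u , v)) →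
               ∀ {xs} → Linked R xs → All P (arcs xs) → All Q (arcs xs)
All-arcs-map f {[]}         _        []       = []
All-arcs-map f {_ ∷ []}     _        []       = []
All-arcs-map f {_ ∷ _ ∷ _} (r ∷ rs) (p ∷ ps) = f r p ∷ All-arcs-map f rs ps

last-lastTwo : ∀ {n} (a b : Fin n) rest →
               last (a ∷ b ∷ rest) ≡ just (proj₂ (lastTwo a b rest))
last-lastTwo a b []      = refl
last-lastTwo a b (c ∷ p) = last-lastTwo b c p

lastTwo∈arcs : ∀ {n} (a b : Fin n) rest → lastTwo a b rest ∈ arcs (a ∷ b ∷ rest)
lastTwo∈arcs a b []      = here refl
lastTwo∈arcs a b (c ∷ p) = there (lastTwo∈arcs b c p)

penultimate∈ : ∀ {n} (a b : Fin n) rest → proj₁ (lastTwo a b rest) ∈ a ∷ b ∷ rest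
penultimate∈ a b []      = here refl
penultimate∈ a b (c ∷ p) = there (penultimate∈ b c p)

Linked-arcs : ∀ {n} {R : Fin n → Fin n → Set} {xs u v} →
              Linked R xs → (u , v) ∈ arcs xs → R u v
Linked-arcs {xs = _ ∷ _ ∷ _} (r ∷ _)  (here refl) = r
Linked-arcs {xs = _ ∷ _ ∷ _} (_ ∷ rs) (there e∈) = Linked-arcs rs e∈

head-arcs⇒∈ : ∀ {n} p {u v : Fin n} → head (arcs p) ≡ just (u , v) → v ∈ p
head-arcs⇒∈ (_ ∷ _ ∷ _) refl = there (here refl)

last-arcs⇒∈ : ∀ {n} p {u v : Fin n} → last (arcs p) ≡ just (u , v) → u ∈ p
last-arcs⇒∈ (_ ∷ _ ∷ [])    refl = here refl
last-arcs⇒∈ (_ ∷ b ∷ c ∷ p) eq   = there (last-arcs⇒∈ (b ∷ c ∷ p) eq)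

last-arcs-++ : ∀ {n} q {a b : Fin n} → last (arcs (q ++ a ∷ b ∷ [])) ≡ just (a , b)
last-arcs-++ []              = refl
last-arcs-++ (_ ∷ [])        = refl
last-arcs-++ (_ ∷ c ∷ [])    = refl
last-arcs-++ (_ ∷ c ∷ d ∷ q) = last-arcs-++ (c ∷ d ∷ q)

AllPairs-≢-disjoint : ∀ {A : Set} {w : A} xs {ys} →
                      AllPairs _≢_ (xs ++ ys) → w ∈ xs → w ∈ ys → ⊥
AllPairs-≢-disjoint (_ ∷ xs) (x≢ ∷ _) (here refl) w∈ys = All.lookup x≢ (∈-++⁺ʳ xs w∈ys) refl
AllPairs-≢-disjoint (_ ∷ xs) (_ ∷ ≢s) (there w∈)  w∈ys = AllPairs-≢-disjoint xs ≢s w∈ w∈ys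

module TreePaths {n : ℕ} (T : Tree n) where
  open Tree T
  open DecMembership (_≟ᶠ_ {n}) using (_∈?_)

  data Path : Fin n → Fin n → List (Fin n) → Set where
    stop : ∀ x → Path x x (x ∷ [])
    step : ∀ {x y w p} → Adj x y → Path y w p → x ∉ p → Path x w (x ∷ p)

  source∈ : ∀ {x y p} → Path x y p → x ∈ p
  source∈ (stop x)     = here refl
  source∈ (step _ _ _) = here refl

  target∈ : ∀ {x y p} → Path x y p → y ∈ p
  target∈ (stop x)     = here refl
  target∈ (step _ q _) = there (target∈ q)

  source∉tail : ∀ {x y q} → Path x y (x ∷ q) → x ∉ q
  source∉tail (stop x)       ()
  source∉tail (step _ _ x∉q) = x∉q

  Path-head : ∀ {x y p} → Path x y p → Σ (List (Fin n)) λ q → p ≡ x ∷ q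
  Path-head (stop x)             = [] , refl
  Path-head (step {p = p} _ _ _) = p , refl

  Path-∷ʳ : ∀ {x w y p} → Path x w p → Adj w y → y ∉ p → Path x y (p ∷ʳ y)
  Path-∷ʳ (stop x) wy y∉ = step wy (stop _) λ { (here x≡y) → y∉ (here (sym x≡y)) }
  Path-∷ʳ (step {p = p} a q x∉p) wy y∉ =
    step a (Path-∷ʳ q wy (y∉ ∘′ there))
      λ x∈ → [ x∉p , (λ { (here x≡y) → y∉ (here (sym x≡y)) }) ]′ (∈-++⁻ p x∈)

  Path-reverse : ∀ {x y p} → Path x y p → Path y x (reverse p)
  Path-reverse (stop x) = stop x
  Path-reverse (step {x = x} {p = p} a q x∉p) =
    subst (Path _ x) (sym (unfold-reverse x p))
      (Path-∷ʳ (Path-reverse q) (symmetric a) (x∉p ∘′ reverse⁻))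

  record Split (x y v : Fin n) (p : List (Fin n)) : Set where
    field
      before after : List (Fin n)
      split-eq     : p ≡ before ++ v ∷ after
      prefix       : Path x v (before ∷ʳ v)
      suffix       : Path v y (v ∷ after)

    prefix⊆ : ∀ {u} → u ∈ before ∷ʳ v → u ∈ p
    prefix⊆ u∈ with ∈-++⁻ before u∈
    ... | inj₁ u∈before  = subst (_ ∈_) (sym split-eq) (∈-++⁺ˡ u∈before)
    ... | inj₂ (here u≡v) = subst (_ ∈_) (sym split-eq) (∈-++⁺ʳ before (here u≡v))

    suffix⊆ : ∀ {u} → u ∈ v ∷ after → u ∈ p
    suffix⊆ u∈ = subst (_ ∈_) (sym split-eq) (∈-++⁺ʳ before u∈)

  split : ∀ {x y p v} → Path x y p → v ∈ p → Split x y v p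
  split (stop x) (here refl) = record
    { before = [] ; after = [] ; split-eq = refl ; prefix = stop x ; suffix = stop x }
  split (step {p = p} a q x∉p) (here refl) = record
    { before = [] ; after = p ; split-eq = refl ; prefix = stop _ ; suffix = step a q x∉p }
  split {x} (step a q x∉p) (there v∈p) = record
    { before   = x ∷ before
    ; after    = after
    ; split-eq = cong (x ∷_) split-eq
    ; prefix   = step a prefix (x∉p ∘′ prefix⊆)
    ; suffix   = suffix
    }
    where open Split (split q v∈p)

  -- Concatenation of two paths with the cycle it may create cut out.
  Path-join : ∀ {x w y p q} → Path x w p → Path w y q →
              Σ (List (Fin n)) λ r → Path x y r × (∀ {u} → u ∈ r → u ∈ p ⊎ u ∈ q)
  Path-join (stop x) q = _ , q , inj₂
  Path-join {x} (step {p = p} a q x∉p) q′ with Path-join q q′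
  ... | r , pr , r⊆ with x ∈? r
  ...   | yes x∈r = x ∷ after , suffix , weaken ∘′ r⊆ ∘′ suffix⊆
    where open Split (split pr x∈r)
          weaken : ∀ {u} → u ∈ p ⊎ u ∈ _ → u ∈ x ∷ p ⊎ u ∈ _
          weaken = [ inj₁ ∘′ there , inj₂ ]′
  ...   | no x∉r = x ∷ r , step a pr x∉r ,
    λ { (here u≡x)  → inj₁ (here u≡x)
      ; (there u∈r) → [ inj₁ ∘′ there , inj₂ ]′ (r⊆ u∈r) }

  Path⇒PathFromTo : ∀ {x y p} → Path x y p → PathFromTo Adj x y p
  Path⇒PathFromTo (stop x) = ([-] , [] ∷ []) , refl , refl
  Path⇒PathFromTo (step a (stop y) x∉p) =
    (a ∷ [-] , ¬Any⇒All¬ _ x∉p ∷ [] ∷ []) , refl , refl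
  Path⇒PathFromTo (step a q@(step _ _ _) x∉p) with Path⇒PathFromTo q
  ... | (linked , distinct) , _ , last≡ =
    (a ∷ linked , ¬Any⇒All¬ _ x∉p ∷ distinct) , refl , last≡

  PathFromTo⇒Path : ∀ {x y} p → PathFromTo Adj x y p → Path x y p
  PathFromTo⇒Path (a ∷ []) (_ , refl , refl) = stop a
  PathFromTo⇒Path (a ∷ b ∷ p) ((adj ∷ linked , a∉ ∷ distinct) , refl , last≡) =
    step adj (PathFromTo⇒Path (b ∷ p) ((linked , distinct) , refl , last≡)) (All¬⇒¬Any a∉)

  -- If two paths from x left through different neighbours c₁ and c₂, joining
  -- the rest of the first with the reversal of the second would close a cycle
  -- through x.
  Path-unique : ∀ {x y p q} → Path x y p → Path x y q → p ≡ q
  Path-unique (stop x)      (stop x)       = refl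
  Path-unique (stop x)      (step _ q x∉q) = ⊥-elim (x∉q (target∈ q))
  Path-unique (step _ p x∉p) (stop x)      = ⊥-elim (x∉p (target∈ p))
  Path-unique {x} (step {y = c₁} a₁ p₁ x∉p₁) (step {y = c₂} a₂ p₂ x∉p₂)
    with c₁ ≟ᶠ c₂
  ... | yes refl = cong (x ∷_) (Path-unique p₁ p₂)
  ... | no c₁≢c₂ with Path-join p₁ (Path-reverse p₂)
  ...   | r , pr , r⊆ =
    ⊥-elim (acyclic (x ∷ r)
      (three≤ pr , proj₁ cycle , x , c₂ , refl , proj₂ (proj₂ cycle) , symmetric a₂))
    where
      x∉r : x ∉ r
      x∉r x∈r = [ x∉p₁ , x∉p₂ ∘′ reverse⁻ ]′ (r⊆ x∈r)
      cycle : PathFromTo Adj x c₂ (x ∷ r)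
      cycle = Path⇒PathFromTo (step a₁ pr x∉r)
      three≤ : ∀ {r} → Path c₁ c₂ r → 3 ≤ length (x ∷ r)
      three≤ (stop _)                = ⊥-elim (c₁≢c₂ refl)
      three≤ (step _ (stop _) _)     = s≤s (s≤s (s≤s z≤n))
      three≤ (step _ (step _ _ _) _) = s≤s (s≤s (s≤s z≤n))

  path : Fin n → Fin n → List (Fin n)
  path x y = proj₁ (connected x y)

  path-Path : ∀ x y → Path x y (path x y)
  path-Path x y = PathFromTo⇒Path (path x y) (proj₂ (connected x y))

  ∈-path-sym : ∀ {v x y} → v ∈ path x y ⇔ v ∈ path y x
  ∈-path-sym = mk⇔ flip∈ flip∈
    where
      flip∈ : ∀ {v x y} → v ∈ path x y → v ∈ path y x
      flip∈ {v} {x} {y} v∈ =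
        reverse⁻ (subst (v ∈_) (Path-unique (path-Path x y) (Path-reverse (path-Path y x)))
                          v∈)

  Path-via-neighbourʳ : ∀ {a b x p} → Adj a b → Path x b p → a ∈ p →
                        Σ (List (Fin n)) λ q → p ≡ q ++ a ∷ b ∷ []
  Path-via-neighbourʳ {a} {b} ab q a∈q =
    before , trans split-eq (cong (λ r → before ++ a ∷ r) after≡)
    where
      open Split (split q a∈q)
      a∉b : a ∉ b ∷ []
      a∉b (here refl) = irrefl ab
      after≡ : after ≡ b ∷ []
      after≡ = ∷-injectiveʳ (Path-unique suffix (step ab (stop b) a∉b))

  Path-via-neighbour : ∀ {a b y p} → Adj a b → Path a y p → b ∈ p →
                       Σ (List (Fin n)) λ q → p ≡ a ∷ q × Path b y q
  Path-via-neighbour ab (stop a)      (here refl) = ⊥-elim (irrefl ab)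
  Path-via-neighbour ab (step _ _ _)  (here refl) = ⊥-elim (irrefl ab)
  Path-via-neighbour {b = b} {y} ab (step {p = p} a q x∉p) (there b∈p) =
    p , refl , subst (Path b y) (sym (∷-injectiveʳ (Path-unique (step a q x∉p) viaB))) suffix
    where
      open Split (split q b∈p)
      viaB : Path _ y (_ ∷ b ∷ after)
      viaB = step ab suffix (x∉p ∘′ suffix⊆)

module RootedTree {n : ℕ} (T : Tree n) (z : Fin n) where
  open Equivalence using (to; from)
  open Tree T
  open TreePaths T
  open DecMembership (_≟ᶠ_ {n}) using (_∈?_)

  rootPath : Fin n → List (Fin n)
  rootPath v = path v z

  rootPath-Path : ∀ v → Path v z (rootPath v)
  rootPath-Path v = path-Path v z

  rootPath-head : ∀ v → Σ (List (Fin n)) λ q → rootPath v ≡ v ∷ q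
  rootPath-head v = Path-head (rootPath-Path v)

  depth : Fin n → ℕ
  depth v = length (rootPath v)

  infix 4 _⊑_ _↑_

  _⊑_ : Fin n → Fin n → Set
  x ⊑ y = x ∈ rootPath y

  _⊑?_ : ∀ x y → Dec (x ⊑ y)
  x ⊑? y = x ∈? rootPath y

  _↑_ : Fin n → Fin n → Set
  a ↑ b = rootPath a ≡ a ∷ rootPath b

  Comparable : Fin n → Fin n → Set
  Comparable x y = x ⊑ y ⊎ y ⊑ x

  Comparable-stable : ∀ x y → ¬ ¬ Comparable x y → Comparable x y
  Comparable-stable x y = decidable-stable ((x ⊑? y) ⊎-dec (y ⊑? x))

  ⊑-refl : ∀ x → x ⊑ x
  ⊑-refl x = subst (x ∈_) (sym (proj₂ (rootPath-head x))) (here refl)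

  ⊑-trans : ∀ {x y w} → x ⊑ y → y ⊑ w → x ⊑ w
  ⊑-trans {x} {y} x⊑y y⊑w =
    suffix⊆ (subst (x ∈_) (Path-unique (rootPath-Path y) suffix) x⊑y)
    where open Split (split (rootPath-Path _) y⊑w)

  ⊑-comparable : ∀ {x x′ y} → x ⊑ y → x′ ⊑ y → Comparable x x′
  ⊑-comparable {x} {x′} {y} x⊑y x′⊑y =
    Sum.map (subst (x ∈_) (suffix≡rootPath S′)) (subst (x′ ∈_) (suffix≡rootPath S))
      (suffixes-nested (Split.before S) (Split.before S′)
        (trans (sym (Split.split-eq S)) (Split.split-eq S′)))
    where
      S  = split (rootPath-Path y) x⊑y
      S′ = split (rootPath-Path y) x′⊑y
      suffix≡rootPath : ∀ {v} (S : Split y z v (rootPath y)) →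
                        v ∷ Split.after S ≡ rootPath v
      suffix≡rootPath S = Path-unique (Split.suffix S) (rootPath-Path _)

  ⊑⇒depth< : ∀ {x y} → x ⊑ y → x ≢ y → depth x < depth y
  ⊑⇒depth< {x} {y} x⊑y x≢y = go before split-eq
    where
      open Split (split (rootPath-Path y) x⊑y)
      go : ∀ bs → rootPath y ≡ bs ++ x ∷ after → depth x < depth y
      go []       eq =
        ⊥-elim (x≢y (sym (∷-injectiveˡ (trans (sym (proj₂ (rootPath-head y))) eq))))
      go (_ ∷ bs) eq
        rewrite eq | sym (Path-unique suffix (rootPath-Path x)) | length-++ bs {x ∷ after}
        = s≤s (m≤n+m _ _)

  ⊑-antisym : ∀ {x y} → x ⊑ y → y ⊑ x → x ≡ y
  ⊑-antisym {x} {y} x⊑y y⊑x with x ≟ᶠ y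
  ... | yes x≡y = x≡y
  ... | no x≢y  = ⊥-elim (<-asym (⊑⇒depth< x⊑y x≢y) (⊑⇒depth< y⊑x (x≢y ∘′ sym)))

  ↑⇒⊑ : ∀ {a b} → a ↑ b → b ⊑ a
  ↑⇒⊑ {b = b} a↑b = subst (b ∈_) (sym a↑b) (there (⊑-refl b))

  ↑⇒⋢ : ∀ {a b} → a ↑ b → ¬ a ⊑ b
  ↑⇒⋢ {a} a↑b = source∉tail (subst (Path a z) a↑b (rootPath-Path a))

  ↑-depth : ∀ {a b} → a ↑ b → depth a ≡ suc (depth b)
  ↑-depth = cong length

  ⊑-↑ : ∀ {c p x} → c ↑ p → x ⊑ c → x ≢ c → x ⊑ p
  ⊑-↑ c↑p x⊑c x≢c with subst (_ ∈_) c↑p x⊑c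
  ... | here x≡c  = ⊥-elim (x≢c x≡c)
  ... | there x⊑p = x⊑p

  Adj⇒↑⊎↓ : ∀ {a b} → Adj a b → a ↑ b ⊎ b ↑ a
  Adj⇒↑⊎↓ {a} {b} ab with a ⊑? b
  ... | no a⋢b = inj₁ (Path-unique (rootPath-Path a) (step ab (rootPath-Path b) a⋢b))
  ... | yes a⊑b with Path-via-neighbour (symmetric ab) (rootPath-Path b) a⊑b
  ...   | q , eq , aq = inj₂ (trans eq (cong (b ∷_) (Path-unique aq (rootPath-Path a))))

  parent∈Path⇔⋢ : ∀ {a b y p} → Adj a b → a ↑ b → Path a y p → (b ∈ p ⇔ (¬ a ⊑ y))
  parent∈Path⇔⋢ {a} {b} {y} ab a↑b ap = mk⇔ parent∈⇒⋢ ⋢⇒parent∈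
    where
      parent∈⇒⋢ : b ∈ _ → ¬ a ⊑ y
      parent∈⇒⋢ b∈p a⊑y with Path-via-neighbour ab ap b∈p
      ... | q , refl , bq with Path-join (Path-reverse bq) (rootPath-Path b)
      ...   | r , yr , r⊆ =
        [ source∉tail ap ∘′ reverse⁻ , ↑⇒⋢ a↑b ]′
          (r⊆ (subst (a ∈_) (Path-unique (rootPath-Path y) yr) a⊑y))
      ⋢⇒parent∈ : ¬ a ⊑ y → b ∈ _
      ⋢⇒parent∈ a⋢y with Path-join (rootPath-Path y) (Path-reverse (rootPath-Path b))
      ... | r , yb , r⊆ =
        subst (b ∈_) (Path-unique (step ab (Path-reverse yb) a∉) ap)
          (there (source∈ (Path-reverse yb)))
        where
          a∉ : a ∉ reverse r
          a∉ a∈ = [ a⋢y , ↑⇒⋢ a↑b ∘′ reverse⁻ ]′ (r⊆ (reverse⁻ a∈))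

  child∈Path⇔⊑ : ∀ {a b y p} → Adj a b → b ↑ a → Path a y p → (b ∈ p ⇔ b ⊑ y)
  child∈Path⇔⊑ {a} {b} {y} ab b↑a ap = mk⇔ child∈⇒⊑ ⊑⇒child∈
    where
      child∈⇒⊑ : b ∈ _ → b ⊑ y
      child∈⇒⊑ b∈p with Path-join (rootPath-Path y) (Path-reverse (rootPath-Path a))
      ... | r , ya , r⊆
          with r⊆ (reverse⁻ (subst (b ∈_) (Path-unique ap (Path-reverse ya)) b∈p))
      ...   | inj₁ b⊑y = b⊑y
      ...   | inj₂ b∈ = ⊥-elim (↑⇒⋢ b↑a (reverse⁻ b∈))
      ⊑⇒child∈ : b ⊑ y → b ∈ _
      ⊑⇒child∈ b⊑y with a ∈? path b y
      ... | yes a∈ = ⊥-elim (to (parent∈Path⇔⋢ (symmetric ab) b↑a (path-Path b y)) a∈ b⊑y)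
      ... | no a∉  =
        subst (b ∈_) (Path-unique (step ab (path-Path b y) a∉) ap) (there (source∈ (path-Path b y)))

  ⊑-along-Path : ∀ {m a y q} → Path a y q → m ⊑ a →
                 (∀ {v} → v ∈ q → depth m ≤ depth v) → m ⊑ y
  ⊑-along-Path (stop _) m⊑a _ = m⊑a
  ⊑-along-Path {m} (step {y = c} ac q _) m⊑a m≤q with Adj⇒↑⊎↓ ac
  ... | inj₂ c↑a = ⊑-along-Path q (⊑-trans m⊑a (↑⇒⊑ c↑a)) (m≤q ∘′ there)
  ... | inj₁ a↑c with subst (m ∈_) a↑c m⊑a
  ...   | there m⊑c = ⊑-along-Path q m⊑c (m≤q ∘′ there)
  ...   | here refl =
    ⊥-elim (1+n≰n (subst (_≤ depth c) (↑-depth a↑c) (m≤q (there (source∈ q)))))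

  ∈-Path-leaving-subtree : ∀ {w a b q} → Path a b q → w ⊑ a → ¬ w ⊑ b → w ∈ q
  ∈-Path-leaving-subtree (stop _) w⊑a w⋢b = ⊥-elim (w⋢b w⊑a)
  ∈-Path-leaving-subtree {w} (step {x = a} {y = c} ac q _) w⊑a w⋢b with w ⊑? c
  ... | yes w⊑c = there (∈-Path-leaving-subtree q w⊑c w⋢b)
  ... | no w⋢c with Adj⇒↑⊎↓ ac
  ...   | inj₂ c↑a = ⊥-elim (w⋢c (⊑-trans w⊑a (↑⇒⊑ c↑a)))
  ...   | inj₁ a↑c with w ≟ᶠ a
  ...     | yes w≡a = here w≡a
  ...     | no w≢a  = ⊥-elim (w⋢c (⊑-↑ a↑c w⊑a w≢a))

  Dist⇒depth : ∀ {u k} → Dist T u z k → depth u ≡ suc k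
  Dist⇒depth (p , up , length≡) =
    trans (cong length (Path-unique (rootPath-Path _) (PathFromTo⇒Path p up))) length≡

  rootDist : ∀ u → Dist T u z (length (proj₁ (rootPath-head u)))
  rootDist u =
    rootPath u , Path⇒PathFromTo (rootPath-Path u) , cong length (proj₂ (rootPath-head u))

  Converging-arc⇔depth< : ∀ {u v} → Converging-arc T z (u , v) ⇔ depth v < depth u
  Converging-arc⇔depth< {u} {v} = mk⇔
    (λ conv → subst₂ _<_ (sym (Dist⇒depth (rootDist v))) (sym (Dist⇒depth (rootDist u)))
                (s≤s (conv _ _ (rootDist u) (rootDist v))))
    (λ v<u _ _ du dv → s<s⁻¹ (subst₂ _<_ (Dist⇒depth dv) (Dist⇒depth du) v<u))

  Converging-arc⇔↑ : ∀ {u v} → Adj u v → Converging-arc T z (u , v) ⇔ u ↑ v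
  Converging-arc⇔↑ {u} {v} uv = mk⇔ conv⇒↑ (from Converging-arc⇔depth< ∘′ depth<)
    where
      depth< : ∀ {a b} → a ↑ b → depth b < depth a
      depth< a↑b = subst (_ <_) (sym (↑-depth a↑b)) ≤-refl
      conv⇒↑ : Converging-arc T z (u , v) → u ↑ v
      conv⇒↑ conv with Adj⇒↑⊎↓ uv
      ... | inj₁ u↑v = u↑v
      ... | inj₂ v↑u = ⊥-elim (<-asym (to Converging-arc⇔depth< conv) (depth< v↑u))

  Diverging-arc⇔↓ : ∀ {u v} → Adj u v → Diverging-arc T z (u , v) ⇔ v ↑ u
  Diverging-arc⇔↓ {u} {v} uv =
    mk⇔ div⇒↓ λ v↑u conv → ↑⇒⋢ v↑u (↑⇒⊑ (to (Converging-arc⇔↑ uv) conv))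
    where
      div⇒↓ : Diverging-arc T z (u , v) → v ↑ u
      div⇒↓ div with Adj⇒↑⊎↓ uv
      ... | inj₁ u↑v = ⊥-elim (div (from (Converging-arc⇔↑ uv) u↑v))
      ... | inj₂ v↑u = v↑u

  Ascending : List (Fin n) → Set
  Ascending p = All (uncurry _↑_) (arcs p)

  Descending : List (Fin n) → Set
  Descending p = All (uncurry (flip _↑_)) (arcs p)

  ConvergingPath⇔Ascending : ∀ {p} → Linked Adj p → ConvergingPath T z p ⇔ Ascending p
  ConvergingPath⇔Ascending linked = mk⇔
    (All-arcs-map (to ∘′ Converging-arc⇔↑) linked)
    (All-arcs-map (from ∘′ Converging-arc⇔↑) linked)

  DivergingPath⇔Descending : ∀ {p} → Linked Adj p → DivergingPath T z p ⇔ Descending p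
  DivergingPath⇔Descending linked = mk⇔
    (All-arcs-map (to ∘′ Diverging-arc⇔↓) linked)
    (All-arcs-map (from ∘′ Diverging-arc⇔↓) linked)

  arcs-∷ : ∀ {x c y p} → Path c y p → arcs (x ∷ p) ≡ (x , c) ∷ arcs p
  arcs-∷ (stop _)     = refl
  arcs-∷ (step _ _ _) = refl

  Ascending-⊑-source : ∀ {x y p v} → Path x y p → Ascending p → v ∈ p → v ⊑ x
  Ascending-⊑-source (stop x)     _   (here refl) = ⊑-refl x
  Ascending-⊑-source (step _ _ _) _   (here refl) = ⊑-refl _
  Ascending-⊑-source (step _ q _) asc (there v∈q) =
    ⊑-trans (Ascending-⊑-source q (All.tail asc′) v∈q) (↑⇒⊑ (All.head asc′))
    where asc′ = subst (All _) (arcs-∷ q) asc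

  Descending-⊑-target : ∀ {x y p v} → Path x y p → Descending p → v ∈ p → v ⊑ y
  Descending-⊑-target (stop x)     _    (here refl) = ⊑-refl x
  Descending-⊑-target (step _ q _) desc (here refl) =
    ⊑-trans (↑⇒⊑ (All.head desc′)) (Descending-⊑-target q (All.tail desc′) (source∈ q))
    where desc′ = subst (All _) (arcs-∷ q) desc
  Descending-⊑-target (step _ q _) desc (there v∈q) =
    Descending-⊑-target q (All.tail (subst (All _) (arcs-∷ q) desc)) v∈q

  ⊑⇒Descending : ∀ {x y p} → Path x y p → x ⊑ y → Descending p
  ⊑⇒Descending (stop x) _ = []
  ⊑⇒Descending (step ac q x∉q) x⊑y with Adj⇒↑⊎↓ ac
  ... | inj₁ x↑c =
    ⊥-elim (to (parent∈Path⇔⋢ ac x↑c (step ac q x∉q)) (there (source∈ q)) x⊑y)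
  ... | inj₂ c↑x = subst (All _) (sym (arcs-∷ q))
    (c↑x ∷ ⊑⇒Descending q (to (child∈Path⇔⊑ ac c↑x (step ac q x∉q)) (there (source∈ q))))

  ⊒⇒Ascending : ∀ {x y p} → Path x y p → y ⊑ x → Ascending p
  ⊒⇒Ascending (stop x) _ = []
  ⊒⇒Ascending (step xc q x∉q) y⊑x with Adj⇒↑⊎↓ xc
  ... | inj₁ x↑c = subst (All _) (sym (arcs-∷ q))
    (x↑c ∷ ⊒⇒Ascending q (⊑-↑ x↑c y⊑x λ { refl → x∉q (target∈ q) }))
  ... | inj₂ c↑x = ⊥-elim (↑⇒⋢ c↑x
    (⊑-trans (to (child∈Path⇔⊑ xc c↑x (step xc q x∉q)) (there (source∈ q))) y⊑x))

  Ancestor⇔⊑ : ∀ {x y} → Ancestor T z x y ⇔ x ⊑ y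
  Ancestor⇔⊑ {x} {y} = mk⇔ Ancestor⇒⊑ ⊑⇒Ancestor
    where
      Ancestor⇒⊑ : Ancestor T z x y → x ⊑ y
      Ancestor⇒⊑ (p , xy , div) =
        Descending-⊑-target xp (to (DivergingPath⇔Descending (proj₁ (proj₁ xy))) div) (source∈ xp)
        where xp : Path x y p
              xp = PathFromTo⇒Path p xy
      ⊑⇒Ancestor : x ⊑ y → Ancestor T z x y
      ⊑⇒Ancestor x⊑y = path x y , xy ,
        from (DivergingPath⇔Descending (proj₁ (proj₁ xy))) (⊑⇒Descending (path-Path x y) x⊑y)
        where xy : PathFromTo Adj x y (path x y)
              xy = proj₂ (connected x y)

  Related⇔Comparable : ∀ {x y} → Related T z x y ⇔ Comparable x y
  Related⇔Comparable = mk⇔ (Sum.map (to Ancestor⇔⊑) (to Ancestor⇔⊑))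
                           (Sum.map (from Ancestor⇔⊑) (from Ancestor⇔⊑))

  record IsMeet (m x y : Fin n) : Set where
    field
      meet⊑ˡ   : m ⊑ x
      meet⊑ʳ   : m ⊑ y
      greatest : ∀ {w} → w ⊑ x → w ⊑ y → w ⊑ m

  ⊑-meet-of-crossing : ∀ {m s t m′ s′ t′} → IsMeet m s t → ¬ Comparable s t →
                       m′ ⊑ s′ → m′ ⊑ t′ → Comparable s t′ → Comparable s′ t → m′ ⊑ m
  ⊑-meet-of-crossing {m} {s} {t} {m′} {s′} {t′} meet s∥t m′⊑s′ m′⊑t′ s~t′ s′~t =
    greatest (m′⊑s s~t′ s′~t) (m′⊑t s′~t s~t′)
    where
      open IsMeet meet
      m′⊑t : Comparable s′ t → Comparable s t′ → m′ ⊑ t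
      m′⊑t (inj₁ s′⊑t) _ = ⊑-trans m′⊑s′ s′⊑t
      m′⊑t (inj₂ t⊑s′) s~t′ with ⊑-comparable m′⊑s′ t⊑s′ | s~t′
      ... | inj₁ m′⊑t | _         = m′⊑t
      ... | inj₂ t⊑m′ | inj₁ s⊑t′ = ⊥-elim (s∥t (⊑-comparable s⊑t′ (⊑-trans t⊑m′ m′⊑t′)))
      ... | inj₂ t⊑m′ | inj₂ t′⊑s = ⊥-elim (s∥t (inj₂ (⊑-trans t⊑m′ (⊑-trans m′⊑t′ t′⊑s))))
      m′⊑s : Comparable s t′ → Comparable s′ t → m′ ⊑ s
      m′⊑s (inj₂ t′⊑s) _ = ⊑-trans m′⊑t′ t′⊑s
      m′⊑s (inj₁ s⊑t′) s′~t with ⊑-comparable m′⊑t′ s⊑t′ | s′~t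
      ... | inj₁ m′⊑s | _         = m′⊑s
      ... | inj₂ s⊑m′ | inj₁ s′⊑t = ⊥-elim (s∥t (inj₁ (⊑-trans s⊑m′ (⊑-trans m′⊑s′ s′⊑t))))
      ... | inj₂ s⊑m′ | inj₂ t⊑s′ = ⊥-elim (s∥t (⊑-comparable (⊑-trans s⊑m′ m′⊑s′) t⊑s′))

module Requests {n : ℕ} (T : Tree n) (z : Fin n) where
  open Equivalence using (to; from)
  open Tree T
  open TreePaths T
  open RootedTree T z

  request-Path : (r : Request T) → Path (src T r) (tgt T r) (verts T r)
  request-Path (request s s⁺ rest isPath) =
    PathFromTo⇒Path _ (isPath , refl , last-lastTwo s s⁺ rest)

  request-Linked : (r : Request T) → Linked Adj (verts T r)
  request-Linked r = proj₁ (Request.isPath r)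

  emission-Adj : (r : Request T) → Adj (src T r) (src⁺ T r)
  emission-Adj (request _ _ _ (adj ∷ _ , _)) = adj

  reception∈arcs : (r : Request T) → (tgt⁻ T r , tgt T r) ∈ arcs (verts T r)
  reception∈arcs (request s s⁺ rest _) = lastTwo∈arcs s s⁺ rest

  reception-Adj : (r : Request T) → Adj (tgt⁻ T r) (tgt T r)
  reception-Adj r = Linked-arcs (request-Linked r) (reception∈arcs r)

  tgt⁻∈ : (r : Request T) → tgt⁻ T r ∈ verts T r
  tgt⁻∈ (request s s⁺ rest _) = penultimate∈ s s⁺ rest

  InterferesOn⇔ : ∀ r r′ → InterferesOn T r r′ ⇔
    (src⁺ T r ∈ path (src T r) (tgt T r′) × tgt⁻ T r′ ∈ path (src T r) (tgt T r′))
  InterferesOn⇔ r r′ = mk⇔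
    (λ { (p , st′ , head≡ , last≡) →
           let p≡ = Path-unique (PathFromTo⇒Path p st′) (path-Path _ _)
           in subst (_ ∈_) p≡ (head-arcs⇒∈ p head≡) , subst (_ ∈_) p≡ (last-arcs⇒∈ p last≡) })
    (λ { (s⁺∈ , t′⁻∈) →
           path _ _ , Path⇒PathFromTo (path-Path _ _) , head≡ s⁺∈ , last≡ t′⁻∈ })
    where
      st′ : List (Fin n)
      st′ = path (src T r) (tgt T r′)
      head≡ : src⁺ T r ∈ st′ → head (arcs st′) ≡ just (src T r , src⁺ T r)
      head≡ s⁺∈ with Path-via-neighbour (emission-Adj r) (path-Path _ _) s⁺∈
      ... | q , eq , s⁺q with Path-head s⁺q
      ...   | _ , refl rewrite eq = refl
      last≡ : tgt⁻ T r′ ∈ st′ → last (arcs st′) ≡ just (tgt⁻ T r′ , tgt T r′)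
      last≡ t′⁻∈ with Path-via-neighbourʳ (reception-Adj r′) (path-Path _ _) t′⁻∈
      ... | q , eq rewrite eq = last-arcs-++ q

  module _ (r : Request T) where
    private
      s s⁺ t⁻ t : Fin n
      s = src T r ; s⁺ = src⁺ T r ; t⁻ = tgt⁻ T r ; t = tgt T r

    emission-up∈⇔ : ∀ {y} → s ↑ s⁺ → s⁺ ∈ path s y ⇔ (¬ s ⊑ y)
    emission-up∈⇔ s↑s⁺ = parent∈Path⇔⋢ (emission-Adj r) s↑s⁺ (path-Path _ _)

    emission-down∈⇔ : ∀ {y} → s⁺ ↑ s → s⁺ ∈ path s y ⇔ s⁺ ⊑ y
    emission-down∈⇔ s⁺↑s = child∈Path⇔⊑ (emission-Adj r) s⁺↑s (path-Path _ _)

    reception-up∈⇔ : ∀ {x} → t⁻ ↑ t → t⁻ ∈ path x t ⇔ t⁻ ⊑ x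
    reception-up∈⇔ t⁻↑t =
      child∈Path⇔⊑ (symmetric (reception-Adj r)) t⁻↑t (path-Path _ _) ⇔-∘ ∈-path-sym

    reception-down∈⇔ : ∀ {x} → t ↑ t⁻ → t⁻ ∈ path x t ⇔ (¬ t ⊑ x)
    reception-down∈⇔ t↑t⁻ =
      parent∈Path⇔⋢ (symmetric (reception-Adj r)) t↑t⁻ (path-Path _ _) ⇔-∘ ∈-path-sym

    Converging⇔Ascending : Converging T z r ⇔ Ascending (verts T r)
    Converging⇔Ascending = ConvergingPath⇔Ascending (request-Linked r)

    Diverging⇔Descending : Diverging T z r ⇔ Descending (verts T r)
    Diverging⇔Descending = DivergingPath⇔Descending (request-Linked r)

    converging-emission : Converging T z r → s ↑ s⁺
    converging-emission = All.head ∘′ to Converging⇔Ascending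

    converging-reception : Converging T z r → t⁻ ↑ t
    converging-reception conv = All.lookup (to Converging⇔Ascending conv) (reception∈arcs r)

    converging-tgt⁻⊑src : Converging T z r → t⁻ ⊑ s
    converging-tgt⁻⊑src conv =
      Ascending-⊑-source (request-Path r) (to Converging⇔Ascending conv) (tgt⁻∈ r)

    diverging-emission : Diverging T z r → s⁺ ↑ s
    diverging-emission = All.head ∘′ to Diverging⇔Descending

    diverging-reception : Diverging T z r → t ↑ t⁻
    diverging-reception div = All.lookup (to Diverging⇔Descending div) (reception∈arcs r)

    diverging-src⁺⊑tgt : Diverging T z r → s⁺ ⊑ t
    diverging-src⁺⊑tgt div =
      Descending-⊑-target (request-Path r) (to Diverging⇔Descending div) (there (here refl))

    -- If the first arc of r descends then s ⊑ s⁺ ⊑ t, so r is diverging;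
    -- dually, if its last arc ascends then t ⊑ t⁻ ⊑ s and r is converging.
    unimodal-emission : Unimodal T z r → s ↑ s⁺
    unimodal-emission (_ , ¬div) with Adj⇒↑⊎↓ (emission-Adj r)
    ... | inj₁ s↑s⁺ = s↑s⁺
    ... | inj₂ s⁺↑s = ⊥-elim (¬div (from Diverging⇔Descending
      (⊑⇒Descending (request-Path r) (⊑-trans (↑⇒⊑ s⁺↑s) s⁺⊑t))))
      where s⁺⊑t : s⁺ ⊑ t
            s⁺⊑t = to (child∈Path⇔⊑ (emission-Adj r) s⁺↑s (request-Path r)) (there (here refl))

    unimodal-reception : Unimodal T z r → t ↑ t⁻
    unimodal-reception (¬conv , _) with Adj⇒↑⊎↓ (reception-Adj r)
    ... | inj₂ t↑t⁻ = t↑t⁻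
    ... | inj₁ t⁻↑t = ⊥-elim (¬conv (from Converging⇔Ascending
      (⊒⇒Ascending (request-Path r) (⊑-trans (↑⇒⊑ t⁻↑t) t⁻⊑s))))
      where t⁻⊑s : t⁻ ⊑ s
            t⁻⊑s = to (child∈Path⇔⊑ (symmetric (reception-Adj r)) t⁻↑t
                            (Path-reverse (request-Path r)))
                      (reverse⁺ (tgt⁻∈ r))

  InterferesOn⇔-↑↑ : ∀ r r′ → src T r ↑ src⁺ T r → tgt⁻ T r′ ↑ tgt T r′ →
                     InterferesOn T r r′ ⇔ ((¬ src T r ⊑ tgt T r′) × tgt⁻ T r′ ⊑ src T r)
  InterferesOn⇔-↑↑ r r′ up up′ =
    (emission-up∈⇔ r up ×-⇔ reception-up∈⇔ r′ up′) ⇔-∘ InterferesOn⇔ r r′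

  InterferesOn⇔-↓↓ : ∀ r r′ → src⁺ T r ↑ src T r → tgt T r′ ↑ tgt⁻ T r′ →
                     InterferesOn T r r′ ⇔ (src⁺ T r ⊑ tgt T r′ × (¬ tgt T r′ ⊑ src T r))
  InterferesOn⇔-↓↓ r r′ down down′ =
    (emission-down∈⇔ r down ×-⇔ reception-down∈⇔ r′ down′) ⇔-∘ InterferesOn⇔ r r′

  InterferesOn⇔-↓↑ : ∀ r r′ → src⁺ T r ↑ src T r → tgt⁻ T r′ ↑ tgt T r′ →
                     InterferesOn T r r′ ⇔ (src⁺ T r ⊑ tgt T r′ × tgt⁻ T r′ ⊑ src T r)
  InterferesOn⇔-↓↑ r r′ down up′ =
    (emission-down∈⇔ r down ×-⇔ reception-up∈⇔ r′ up′) ⇔-∘ InterferesOn⇔ r r′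

  InterferesOn⇔-↑↓ : ∀ r r′ → src T r ↑ src⁺ T r → tgt T r′ ↑ tgt⁻ T r′ →
                     InterferesOn T r r′ ⇔ (¬ Comparable (src T r) (tgt T r′))
  InterferesOn⇔-↑↓ r r′ up down′ =
    mk⇔ (uncurry [_,_]′) (λ ¬cmp → ¬cmp ∘′ inj₁ , ¬cmp ∘′ inj₂)
      ⇔-∘ ((emission-up∈⇔ r up ×-⇔ reception-down∈⇔ r′ down′) ⇔-∘ InterferesOn⇔ r r′)

  IsMiddle⇒depth≤ : ∀ r {m v} → IsMiddle T z r m → v ∈ verts T r → depth m ≤ depth v
  IsMiddle⇒depth≤ r (_ , minimal) v∈ =
    subst₂ _≤_ (sym (Dist⇒depth (rootDist _))) (sym (Dist⇒depth (rootDist _)))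
      (s≤s (minimal _ v∈ _ _ (rootDist _) (rootDist _)))

  -- m splits r into two subpaths, both staying below m; a common ancestor w of
  -- the ends that were not above m would have to lie on both subpaths.
  IsMiddle⇒IsMeet : ∀ r {m} → IsMiddle T z r m → IsMeet m (src T r) (tgt T r)
  IsMiddle⇒IsMeet r {m} middle = record { meet⊑ˡ = m⊑s ; meet⊑ʳ = m⊑t ; greatest = greatest }
    where
      open Split (split (request-Path r) (proj₁ middle))
      m⊑t : m ⊑ tgt T r
      m⊑t = ⊑-along-Path suffix (⊑-refl m) (IsMiddle⇒depth≤ r middle ∘′ suffix⊆)
      m⊑s : m ⊑ src T r
      m⊑s = ⊑-along-Path (Path-reverse prefix) (⊑-refl m)
              (IsMiddle⇒depth≤ r middle ∘′ prefix⊆ ∘′ reverse⁻)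
      greatest : ∀ {w} → w ⊑ src T r → w ⊑ tgt T r → w ⊑ m
      greatest {w} w⊑s w⊑t with ⊑-comparable w⊑s m⊑s
      ... | inj₁ w⊑m = w⊑m
      ... | inj₂ m⊑w with w ≟ᶠ m
      ...   | yes refl = ⊑-refl m
      ...   | no w≢m = ⊥-elim (AllPairs-≢-disjoint before distinct w∈before w∈after)
        where
          w⋢m : ¬ w ⊑ m
          w⋢m w⊑m = w≢m (⊑-antisym w⊑m m⊑w)
          distinct : AllPairs _≢_ (before ++ m ∷ after)
          distinct = subst (AllPairs _≢_) split-eq (proj₂ (Request.isPath r))
          w∈before : w ∈ before
          w∈before with ∈-++⁻ before (∈-Path-leaving-subtree prefix w⊑s w⋢m)
          ... | inj₁ w∈ = w∈
          ... | inj₂ (here w≡m) = ⊥-elim (w≢m w≡m)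
          w∈after : w ∈ m ∷ after
          w∈after = reverse⁻ (∈-Path-leaving-subtree (Path-reverse suffix) w⊑t w⋢m)

  unimodal-ends-incomparable : ∀ r {m} → Unimodal T z r → IsMiddle T z r m →
                               ¬ Comparable (src T r) (tgt T r)
  unimodal-ends-incomparable r uni middle = [ s⋢t , t⋢s ]′
    where
      open IsMeet (IsMiddle⇒IsMeet r middle)
      -- an end equal to m would have its neighbour on r strictly above m
      s⋢t : ¬ src T r ⊑ tgt T r
      s⋢t s⊑t with ⊑-antisym (greatest (⊑-refl _) s⊑t) meet⊑ˡ
      ... | refl = 1+n≰n (subst (_≤ depth (src⁺ T r)) (↑-depth (unimodal-emission r uni))
                                (IsMiddle⇒depth≤ r middle (there (here refl))))
      t⋢s : ¬ tgt T r ⊑ src T r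
      t⋢s t⊑s with ⊑-antisym (greatest t⊑s (⊑-refl _)) meet⊑ʳ
      ... | refl = 1+n≰n (subst (_≤ depth (tgt⁻ T r)) (↑-depth (unimodal-reception r uni))
                                (IsMiddle⇒depth≤ r middle (tgt⁻∈ r)))

module Interference {n : ℕ} (T : Tree n) (z : Fin n) where
  open Equivalence using (to; from)
  open RootedTree T z
  open Requests T z

  converging-interfere⇔ : ∀ r r′ → Converging T z r → Converging T z r′ →
                          Interfere T r r′ ⇔ Related T z (tgt⁻ T r) (tgt⁻ T r′)
  converging-interfere⇔ r r′ conv conv′ =
    ⇔-sym Related⇔Comparable ⇔-∘
      mk⇔ [ comparable r r′ conv conv′ , swap ∘′ comparable r′ r conv′ conv ]′
          [ inj₂ ∘′ interferes r r′ conv conv′ , inj₁ ∘′ interferes r′ r conv′ conv ]′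
    where
      interferesOn⇔ : ∀ ρ ρ′ → Converging T z ρ → Converging T z ρ′ →
                      InterferesOn T ρ ρ′ ⇔ ((¬ src T ρ ⊑ tgt T ρ′) × tgt⁻ T ρ′ ⊑ src T ρ)
      interferesOn⇔ ρ ρ′ c c′ =
        InterferesOn⇔-↑↑ ρ ρ′ (converging-emission ρ c) (converging-reception ρ′ c′)
      comparable : ∀ ρ ρ′ → Converging T z ρ → Converging T z ρ′ →
                   InterferesOn T ρ ρ′ → Comparable (tgt⁻ T ρ) (tgt⁻ T ρ′)
      comparable ρ ρ′ c c′ io =
        ⊑-comparable (converging-tgt⁻⊑src ρ c) (proj₂ (to (interferesOn⇔ ρ ρ′ c c′) io))
      interferes : ∀ ρ ρ′ → Converging T z ρ → Converging T z ρ′ →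
                   tgt⁻ T ρ ⊑ tgt⁻ T ρ′ → InterferesOn T ρ′ ρ
      interferes ρ ρ′ c c′ t⁻⊑t′⁻ = from (interferesOn⇔ ρ′ ρ c′ c)
        ((λ s′⊑t → ↑⇒⋢ (converging-reception ρ c) (⊑-trans t⁻⊑s′ s′⊑t)) , t⁻⊑s′)
        where t⁻⊑s′ : tgt⁻ T ρ ⊑ src T ρ′
              t⁻⊑s′ = ⊑-trans t⁻⊑t′⁻ (converging-tgt⁻⊑src ρ′ c′)

  diverging-interfere⇔ : ∀ r r′ → Diverging T z r → Diverging T z r′ →
                         Interfere T r r′ ⇔ Related T z (src⁺ T r) (src⁺ T r′)
  diverging-interfere⇔ r r′ div div′ =
    ⇔-sym Related⇔Comparable ⇔-∘
      mk⇔ [ comparable r r′ div div′ , swap ∘′ comparable r′ r div′ div ]′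
          [ inj₁ ∘′ interferes r r′ div div′ , inj₂ ∘′ interferes r′ r div′ div ]′
    where
      interferesOn⇔ : ∀ ρ ρ′ → Diverging T z ρ → Diverging T z ρ′ →
                      InterferesOn T ρ ρ′ ⇔ (src⁺ T ρ ⊑ tgt T ρ′ × (¬ tgt T ρ′ ⊑ src T ρ))
      interferesOn⇔ ρ ρ′ d d′ =
        InterferesOn⇔-↓↓ ρ ρ′ (diverging-emission ρ d) (diverging-reception ρ′ d′)
      comparable : ∀ ρ ρ′ → Diverging T z ρ → Diverging T z ρ′ →
                   InterferesOn T ρ ρ′ → Comparable (src⁺ T ρ) (src⁺ T ρ′)
      comparable ρ ρ′ d d′ io =
        ⊑-comparable (proj₁ (to (interferesOn⇔ ρ ρ′ d d′) io)) (diverging-src⁺⊑tgt ρ′ d′)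
      interferes : ∀ ρ ρ′ → Diverging T z ρ → Diverging T z ρ′ →
                   src⁺ T ρ ⊑ src⁺ T ρ′ → InterferesOn T ρ ρ′
      interferes ρ ρ′ d d′ s⁺⊑s′⁺ = from (interferesOn⇔ ρ ρ′ d d′)
        (s⁺⊑t′ , λ t′⊑s → ↑⇒⋢ (diverging-emission ρ d) (⊑-trans s⁺⊑t′ t′⊑s))
        where s⁺⊑t′ : src⁺ T ρ ⊑ tgt T ρ′
              s⁺⊑t′ = ⊑-trans s⁺⊑s′⁺ (diverging-src⁺⊑tgt ρ′ d′)

  converging-diverging-interfere⇔ : ∀ r r′ → Converging T z r → Diverging T z r′ →
                                    Interfere T r r′ ⇔ (¬ Related T z (src T r) (tgt T r′))
  converging-diverging-interfere⇔ r r′ conv div′ =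
    mk⇔ (λ ¬cmp → ¬cmp ∘′ to Related⇔Comparable) (λ ¬rel → ¬rel ∘′ from Related⇔Comparable)
      ⇔-∘ mk⇔ [ to interferesOn⇔ , ⊥-elim ∘′ ¬interferesOn′ ]′
              (inj₁ ∘′ from interferesOn⇔)
    where
      interferesOn⇔ : InterferesOn T r r′ ⇔ (¬ Comparable (src T r) (tgt T r′))
      interferesOn⇔ =
        InterferesOn⇔-↑↓ r r′ (converging-emission r conv) (diverging-reception r′ div′)
      -- t⁻ ⊑ s′ ⊑ s′⁺ ⊑ t would put the child t⁻ above its parent t
      ¬interferesOn′ : ¬ InterferesOn T r′ r
      ¬interferesOn′ io
        with to (InterferesOn⇔-↓↑ r′ r (diverging-emission r′ div′)
                                        (converging-reception r conv)) io
      ... | s′⁺⊑t , t⁻⊑s′ = ↑⇒⋢ (converging-reception r conv)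
        (⊑-trans t⁻⊑s′ (⊑-trans (↑⇒⊑ (diverging-emission r′ div′)) s′⁺⊑t))

  unimodal-¬interfere⇔ : ∀ r r′ → Unimodal T z r → Unimodal T z r′ →
    ∀ m m′ → IsMiddle T z r m → IsMiddle T z r′ m′ →
    ((¬ Interfere T r r′) ⇔
      (m ≡ m′ × Related T z (src T r) (tgt T r′) × Related T z (src T r′) (tgt T r)))
  unimodal-¬interfere⇔ r r′ uni uni′ m m′ middle middle′ = mk⇔
    (λ ¬int →
      let s~t′ = comparable r r′ uni uni′ (¬int ∘′ inj₁)
          s′~t = comparable r′ r uni′ uni (¬int ∘′ inj₂)
      in ⊑-antisym (⊑-meet-of-crossing meet′ (unimodal-ends-incomparable r′ uni′ middle′)
                      (IsMeet.meet⊑ˡ meet) (IsMeet.meet⊑ʳ meet) s′~t s~t′)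
                   (⊑-meet-of-crossing meet (unimodal-ends-incomparable r uni middle)
                      (IsMeet.meet⊑ˡ meet′) (IsMeet.meet⊑ʳ meet′) s~t′ s′~t)
         , from Related⇔Comparable s~t′ , from Related⇔Comparable s′~t)
    (λ { (_ , rel , rel′) →
      [ (λ io → to (interferesOn⇔ r r′ uni uni′) io (to Related⇔Comparable rel))
      , (λ io → to (interferesOn⇔ r′ r uni′ uni) io (to Related⇔Comparable rel′)) ]′ })
    where
      meet : IsMeet m (src T r) (tgt T r)
      meet = IsMiddle⇒IsMeet r middle
      meet′ : IsMeet m′ (src T r′) (tgt T r′)
      meet′ = IsMiddle⇒IsMeet r′ middle′
      interferesOn⇔ : ∀ ρ ρ′ → Unimodal T z ρ → Unimodal T z ρ′ →
                      InterferesOn T ρ ρ′ ⇔ (¬ Comparable (src T ρ) (tgt T ρ′))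
      interferesOn⇔ ρ ρ′ u u′ =
        InterferesOn⇔-↑↓ ρ ρ′ (unimodal-emission ρ u) (unimodal-reception ρ′ u′)
      comparable : ∀ ρ ρ′ → Unimodal T z ρ → Unimodal T z ρ′ →
                   ¬ InterferesOn T ρ ρ′ → Comparable (src T ρ) (tgt T ρ′)
      comparable ρ ρ′ u u′ ¬io = Comparable-stable _ _ (¬io ∘′ from (interferesOn⇔ ρ ρ′ u u′))

  unimodal-converging-¬interfere⇔ : ∀ r r′ → Unimodal T z r → Converging T z r′ →
    ∀ m → IsMiddle T z r m →
    ((¬ Interfere T r r′) ⇔
      (Ancestor T z m (tgt T r′) × Related T z (tgt T r) (src T r′)))
  unimodal-converging-¬interfere⇔ r r′ uni conv′ m middle = mk⇔ ¬interfere⇒ ⇒¬interfere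
    where
      open IsMeet (IsMiddle⇒IsMeet r middle)
      s∥t : ¬ Comparable (src T r) (tgt T r)
      s∥t = unimodal-ends-incomparable r uni middle
      t′⁻↑t′ : tgt⁻ T r′ ↑ tgt T r′
      t′⁻↑t′ = converging-reception r′ conv′
      t′⁻⊑s′ : tgt⁻ T r′ ⊑ src T r′
      t′⁻⊑s′ = converging-tgt⁻⊑src r′ conv′
      interferesOn⇔ : InterferesOn T r r′ ⇔ ((¬ src T r ⊑ tgt T r′) × tgt⁻ T r′ ⊑ src T r)
      interferesOn⇔ = InterferesOn⇔-↑↑ r r′ (unimodal-emission r uni) t′⁻↑t′
      interferesOn′⇔ : InterferesOn T r′ r ⇔ (¬ Comparable (src T r′) (tgt T r))
      interferesOn′⇔ =
        InterferesOn⇔-↑↓ r′ r (converging-emission r′ conv′) (unimodal-reception r uni)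

      s′~t : ¬ Interfere T r r′ → Comparable (src T r′) (tgt T r)
      s′~t ¬int = Comparable-stable _ _ (¬int ∘′ inj₂ ∘′ from interferesOn′⇔)

      m~t′⁻ : Comparable (src T r′) (tgt T r) → Comparable m (tgt⁻ T r′)
      m~t′⁻ (inj₁ s′⊑t) = ⊑-comparable meet⊑ʳ (⊑-trans t′⁻⊑s′ s′⊑t)
      m~t′⁻ (inj₂ t⊑s′) = ⊑-comparable (⊑-trans meet⊑ʳ t⊑s′) t′⁻⊑s′

      t′⁻⋢s : ¬ Interfere T r r′ → ¬ src T r ⊑ tgt T r′ → ¬ tgt⁻ T r′ ⊑ src T r
      t′⁻⋢s ¬int s⋢t′ t′⁻⊑s = ¬int (inj₁ (from interferesOn⇔ (s⋢t′ , t′⁻⊑s)))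

      -- if s is not above t′, then m lies strictly below the parent t′ of t′⁻
      m⊑t′ : ¬ Interfere T r r′ → m ⊑ tgt T r′
      m⊑t′ ¬int with src T r ⊑? tgt T r′
      ... | yes s⊑t′ = ⊑-trans meet⊑ˡ s⊑t′
      ... | no s⋢t′ with m~t′⁻ (s′~t ¬int)
      ...   | inj₂ t′⁻⊑m = ⊥-elim (t′⁻⋢s ¬int s⋢t′ (⊑-trans t′⁻⊑m meet⊑ˡ))
      ...   | inj₁ m⊑t′⁻ with m ≟ᶠ tgt⁻ T r′
      ...     | yes refl  = ⊥-elim (t′⁻⋢s ¬int s⋢t′ meet⊑ˡ)
      ...     | no m≢t′⁻ = ⊑-↑ t′⁻↑t′ m⊑t′⁻ m≢t′⁻

      Conditions : Set
      Conditions = Ancestor T z m (tgt T r′) × Related T z (tgt T r) (src T r′)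

      ¬interfere⇒ : ¬ Interfere T r r′ → Conditions
      ¬interfere⇒ ¬int =
        from Ancestor⇔⊑ (m⊑t′ ¬int) , from Related⇔Comparable (swap (s′~t ¬int))

      ⇒¬interfere : Conditions → ¬ Interfere T r r′
      ⇒¬interfere (_ , rel) (inj₂ io′) = to interferesOn′⇔ io′ (swap (to Related⇔Comparable rel))
      ⇒¬interfere (anc , rel) (inj₁ io) = ↑⇒⋢ t′⁻↑t′
        (⊑-trans (greatest t′⁻⊑s (t′⁻⊑t (to Related⇔Comparable rel))) (to Ancestor⇔⊑ anc))
        where
          t′⁻⊑s : tgt⁻ T r′ ⊑ src T r
          t′⁻⊑s = proj₂ (to interferesOn⇔ io)
          t′⁻⊑t : Comparable (tgt T r) (src T r′) → tgt⁻ T r′ ⊑ tgt T r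
          t′⁻⊑t (inj₂ s′⊑t) = ⊑-trans t′⁻⊑s′ s′⊑t
          t′⁻⊑t (inj₁ t⊑s′) with ⊑-comparable t⊑s′ t′⁻⊑s′
          ... | inj₁ t⊑t′⁻ = ⊥-elim (s∥t (inj₂ (⊑-trans t⊑t′⁻ t′⁻⊑s)))
          ... | inj₂ t′⁻⊑t = t′⁻⊑t

  unimodal-diverging-¬interfere⇔ : ∀ r r′ → Unimodal T z r → Diverging T z r′ →
    ∀ m → IsMiddle T z r m →
    ((¬ Interfere T r r′) ⇔
      (Ancestor T z m (src T r′) × Related T z (src T r) (tgt T r′)))
  unimodal-diverging-¬interfere⇔ r r′ uni div′ m middle = mk⇔ ¬interfere⇒ ⇒¬interfere
    where
      open IsMeet (IsMiddle⇒IsMeet r middle)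
      s∥t : ¬ Comparable (src T r) (tgt T r)
      s∥t = unimodal-ends-incomparable r uni middle
      s′⁺↑s′ : src⁺ T r′ ↑ src T r′
      s′⁺↑s′ = diverging-emission r′ div′
      s′⁺⊑t′ : src⁺ T r′ ⊑ tgt T r′
      s′⁺⊑t′ = diverging-src⁺⊑tgt r′ div′
      interferesOn⇔ : InterferesOn T r r′ ⇔ (¬ Comparable (src T r) (tgt T r′))
      interferesOn⇔ =
        InterferesOn⇔-↑↓ r r′ (unimodal-emission r uni) (diverging-reception r′ div′)
      interferesOn′⇔ : InterferesOn T r′ r ⇔ (src⁺ T r′ ⊑ tgt T r × (¬ tgt T r ⊑ src T r′))
      interferesOn′⇔ = InterferesOn⇔-↓↓ r′ r s′⁺↑s′ (unimodal-reception r uni)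

      s~t′ : ¬ Interfere T r r′ → Comparable (src T r) (tgt T r′)
      s~t′ ¬int = Comparable-stable _ _ (¬int ∘′ inj₁ ∘′ from interferesOn⇔)

      m~s′⁺ : Comparable (src T r) (tgt T r′) → Comparable m (src⁺ T r′)
      m~s′⁺ (inj₁ s⊑t′) = ⊑-comparable (⊑-trans meet⊑ˡ s⊑t′) s′⁺⊑t′
      m~s′⁺ (inj₂ t′⊑s) = ⊑-comparable meet⊑ˡ (⊑-trans s′⁺⊑t′ t′⊑s)

      s′⁺⋢t : ¬ Interfere T r r′ → ¬ tgt T r ⊑ src T r′ → ¬ src⁺ T r′ ⊑ tgt T r
      s′⁺⋢t ¬int t⋢s′ s′⁺⊑t = ¬int (inj₂ (from interferesOn′⇔ (s′⁺⊑t , t⋢s′)))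

      -- if t is not above s′, then m lies strictly below the parent s′ of s′⁺
      m⊑s′ : ¬ Interfere T r r′ → m ⊑ src T r′
      m⊑s′ ¬int with tgt T r ⊑? src T r′
      ... | yes t⊑s′ = ⊑-trans meet⊑ʳ t⊑s′
      ... | no t⋢s′ with m~s′⁺ (s~t′ ¬int)
      ...   | inj₂ s′⁺⊑m = ⊥-elim (s′⁺⋢t ¬int t⋢s′ (⊑-trans s′⁺⊑m meet⊑ʳ))
      ...   | inj₁ m⊑s′⁺ with m ≟ᶠ src⁺ T r′
      ...     | yes refl  = ⊥-elim (s′⁺⋢t ¬int t⋢s′ meet⊑ʳ)
      ...     | no m≢s′⁺ = ⊑-↑ s′⁺↑s′ m⊑s′⁺ m≢s′⁺

      Conditions : Set
      Conditions = Ancestor T z m (src T r′) × Related T z (src T r) (tgt T r′)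

      ¬interfere⇒ : ¬ Interfere T r r′ → Conditions
      ¬interfere⇒ ¬int = from Ancestor⇔⊑ (m⊑s′ ¬int) , from Related⇔Comparable (s~t′ ¬int)

      ⇒¬interfere : Conditions → ¬ Interfere T r r′
      ⇒¬interfere (_ , rel) (inj₁ io) = to interferesOn⇔ io (to Related⇔Comparable rel)
      ⇒¬interfere (anc , rel) (inj₂ io′) = ↑⇒⋢ s′⁺↑s′
        (⊑-trans (greatest (s′⁺⊑s (to Related⇔Comparable rel)) s′⁺⊑t) (to Ancestor⇔⊑ anc))
        where
          s′⁺⊑t : src⁺ T r′ ⊑ tgt T r
          s′⁺⊑t = proj₁ (to interferesOn′⇔ io′)
          s′⁺⊑s : Comparable (src T r) (tgt T r′) → src⁺ T r′ ⊑ src T r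
          s′⁺⊑s (inj₂ t′⊑s) = ⊑-trans s′⁺⊑t′ t′⊑s
          s′⁺⊑s (inj₁ s⊑t′) with ⊑-comparable s⊑t′ s′⁺⊑t′
          ... | inj₁ s⊑s′⁺ = ⊥-elim (s∥t (inj₁ (⊑-trans s⊑s′⁺ s′⁺⊑t)))
          ... | inj₂ s′⁺⊑s = s′⁺⊑s

open Interference

lemma1 : ∀ {n} (T : Tree n) (z : Fin n) →
    (∀ (r r' : Request T) → Converging T z r → Converging T z r' →
      (Interfere T r r' ⇔ Related T z (tgt⁻ T r) (tgt⁻ T r'))) ×
    (∀ (r r' : Request T) → Diverging T z r → Diverging T z r' →
      (Interfere T r r' ⇔ Related T z (src⁺ T r) (src⁺ T r'))) ×
    (∀ (r r' : Request T) → Converging T z r → Diverging T z r' →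
      (Interfere T r r' ⇔ (¬ Related T z (src T r) (tgt T r')))) ×
    (∀ (r r' : Request T) → Unimodal T z r → Unimodal T z r' →
      ∀ m m' → IsMiddle T z r m → IsMiddle T z r' m' →
      ((¬ Interfere T r r') ⇔
        (m ≡ m' × Related T z (src T r) (tgt T r') × Related T z (src T r') (tgt T r)))) ×
    (∀ (r r' : Request T) → Unimodal T z r → Converging T z r' →
      ∀ m → IsMiddle T z r m →
      ((¬ Interfere T r r') ⇔
        (Ancestor T z m (tgt T r') × Related T z (tgt T r) (src T r')))) ×
    (∀ (r r' : Request T) → Unimodal T z r → Diverging T z r' →
      ∀ m → IsMiddle T z r m →
      ((¬ Interfere T r r') ⇔
        (Ancestor T z m (src T r') × Related T z (src T r) (tgt T r'))))
lemma1 T z =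
  converging-interfere⇔ T z ,
  diverging-interfere⇔ T z ,
  converging-diverging-interfere⇔ T z ,
  unimodal-¬interfere⇔ T z ,
  unimodal-converging-¬interfere⇔ T z ,
  unimodal-diverging-¬interfere⇔ T z
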